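{- Let $d\in\mathbb{N}$, $C=[-d:d]=\{ -d,\dots,d\}$ and $\mathbf{x}=(x_1,\dots,x_n)\in\mathbb{Z}^n\setminus\{\mathbf{0}\}$. If \[ \frac{\|\mathbf{x}\|_2}{\gcd(x_1,\ldots,x_n)}<(d+1)^{n-1}, \] then there exists $\mathbf{c}\in C^n\setminus\{\mathbf{0}\}$ such that $\mathbf{c}\cdot\mathbf{x}=0$.
   Context: $\|\mathbf{x}\|_2$ is the Euclidean norm and $\mathbf{c}\cdot\mathbf{x}=\sum_i c_ix_i$. -}

module Defs where

open import Data.Nat as ℕ using (ℕ; zero; suc)
open import Data.Nat.GCD using (gcd)
open import Data.Integer as ℤ using (ℤ; +_; -_; ∣_∣)
open import Data.Fin using (Fin; zero; suc)
open import Data.Product using (_×_)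
open import Relation.Binary.PropositionalEquality using (_≡_)
open import Relation.Nullary using (¬_)

sumℕ : ∀ {n} → (Fin n → ℕ) → ℕ
sumℕ {zero}  f = 0
sumℕ {suc n} f = f zero ℕ.+ sumℕ (λ i → f (suc i))

sumℤ : ∀ {n} → (Fin n → ℤ) → ℤ
sumℤ {zero}  f = + 0
sumℤ {suc n} f = f zero ℤ.+ sumℤ (λ i → f (suc i))

_·_ : ∀ {n} → (Fin n → ℤ) → (Fin n → ℤ) → ℤ
c · x = sumℤ (λ i → c i ℤ.* x i)

normSq : ∀ {n} → (Fin n → ℤ) → ℕ
normSq x = sumℕ (λ i → ∣ x i ∣ ℕ.* ∣ x i ∣)

gcdVec : ∀ {n} → (Fin n → ℤ) → ℕ
gcdVec {zero}  x = 0
gcdVec {suc n} x = gcd ∣ x zero ∣ (gcdVec (λ i → x (suc i)))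

0v : ∀ {n} → Fin n → ℤ
0v _ = + 0

NonZeroVec : ∀ {n} → (Fin n → ℤ) → Set
NonZeroVec x = ¬ (∀ i → x i ≡ + 0)

InBox : ℕ → ∀ {n} → (Fin n → ℤ) → Set
InBox d c = ∀ i → (- (+ d) ℤ.≤ c i) × (c i ℤ.≤ + d)

module Submission where

-- Let D = d + 1 and g = gcd(x), and look at the N = Dⁿ values c · x for c ∈ {0,…,d}ⁿ.
-- If two of them coincide, the difference of the two vectors c is the required solution.
-- Otherwise they are N distinct multiples of g, so their spread N·Σv² − (Σv)² (that is,
-- N² times their variance) is at least that of an arithmetic progression of step g,
-- namely g²N²(N² − 1)/12.  On the other hand the coordinates of a uniformly random
-- c ∈ {0,…,d}ⁿ are independent and uniform on {0,…,d}, so the variance of c · x is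
-- exactly (D² − 1)‖x‖²/12.  Hence g²(N² − 1) ≤ (D² − 1)‖x‖² < (D² − 1)g²D²⁽ⁿ⁻¹⁾ = g²(N² − D²⁽ⁿ⁻¹⁾),
-- which is absurd.

open import Defs

open import Algebra using (CommutativeMonoid)
open import Data.Empty using (⊥-elim)
open import Data.Fin using (Fin; zero; suc)
open import Data.Integer as ℤ using (ℤ; +_; -[1+_]; ∣_∣)
import Data.Integer.Properties as ℤ
open import Data.Integer.Divisibility.Signed
  using (_∣_; divides; ∣m∣n⇒∣m+n; ∣m∣n⇒∣m-n; ∣n⇒∣m*n; ∣⇒∣ᵤ; ∣ᵤ⇒∣)
open import Data.Integer.Tactic.RingSolver using (solve-∀)
open import Data.List
  using (List; []; _∷_; _++_; [_]; map; foldr; length; cartesianProductWith; applyDownFrom)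
import Data.List.Properties as List
open import Data.List.Membership.Propositional using (_∈_; find)
open import Data.List.Membership.Propositional.Properties using (∈-applyDownFrom⁻)
open import Data.List.Relation.Binary.Permutation.Propositional using (_↭_; ↭-sym; ↭⇒↭ₛ)
import Data.List.Relation.Binary.Permutation.Propositional.Properties as ↭
import Data.List.Relation.Binary.Permutation.Setoid.Properties as ↭ₛ
open import Data.List.Relation.Unary.All as All using (All; []; _∷_)
import Data.List.Relation.Unary.All.Properties as All
open import Data.List.Relation.Unary.AllPairs using (AllPairs; []; _∷_)
open import Data.List.Relation.Unary.Any as Any using (here; there)
open import Data.List.Relation.Unary.Linked as Linked using (Linked; []; [-]; _∷_)
open import Data.List.Relation.Unary.Unique.Propositional using (Unique)
open import Data.List.Sort ℤ.≤-decTotalOrder using (sort; sort-↭; sort-↗)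
import Data.List.Relation.Unary.Unique.Propositional.Properties as Unique
import Data.List.Relation.Unary.Unique.Setoid as Setoid
import Data.List.Relation.Unary.Unique.Setoid.Properties as Setoid
open import Data.Nat as ℕ using (ℕ; zero; suc)
import Data.Nat.Divisibility as ℕ
open import Data.Nat.GCD using (gcd[m,n]∣m; gcd[m,n]∣n; gcd-identityˡ)
import Data.Nat.Properties as ℕ
open import Data.Product using (Σ; ∃₂; _×_; _,_)
open import Data.Sum using (_⊎_; inj₁; inj₂)
open import Data.Vec.Functional as Vector using (Vector; head; tail)
open import Relation.Binary.Definitions using (DecidableEquality)
open import Relation.Binary.PropositionalEquality
  using (_≡_; _≢_; refl; sym; trans; cong; cong₂; subst; subst₂; setoid; _→-setoid_; module ≡-Reasoning)
open import Relation.Nullary using (¬_; yes; no)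

private variable
  A B C A′ B′ C′ : Set

length-cartesianProductWith : ∀ (f : A → B → C) xs ys →
  length (cartesianProductWith f xs ys) ≡ length xs ℕ.* length ys
length-cartesianProductWith f []       ys = refl
length-cartesianProductWith f (x ∷ xs) ys = begin
  length (map (f x) ys ++ cartesianProductWith f xs ys)
    ≡⟨ List.length-++ (map (f x) ys) ⟩
  length (map (f x) ys) ℕ.+ length (cartesianProductWith f xs ys)
    ≡⟨ cong₂ ℕ._+_ (List.length-map (f x) ys) (length-cartesianProductWith f xs ys) ⟩
  length ys ℕ.+ length xs ℕ.* length ys ∎
  where open ≡-Reasoning

map-cartesianProductWith : ∀ (g : C → C′) (f : A → B → C) xs ys →
  map g (cartesianProductWith f xs ys) ≡ cartesianProductWith (λ x y → g (f x y)) xs ys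
map-cartesianProductWith g f []       ys = refl
map-cartesianProductWith g f (x ∷ xs) ys = begin
  map g (map (f x) ys ++ cartesianProductWith f xs ys)
    ≡⟨ List.map-++ g (map (f x) ys) (cartesianProductWith f xs ys) ⟩
  map g (map (f x) ys) ++ map g (cartesianProductWith f xs ys)
    ≡⟨ cong₂ _++_ (sym (List.map-∘ ys)) (map-cartesianProductWith g f xs ys) ⟩
  map (λ y → g (f x y)) ys ++ cartesianProductWith (λ x y → g (f x y)) xs ys ∎
  where open ≡-Reasoning

cartesianProductWith-map : ∀ (f : A → B → C) (g : A′ → A) (h : B′ → B) xs ys →
  cartesianProductWith f (map g xs) (map h ys) ≡ cartesianProductWith (λ x y → f (g x) (h y)) xs ys
cartesianProductWith-map f g h []       ys = refl
cartesianProductWith-map f g h (x ∷ xs) ys =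
  cong₂ _++_ (sym (List.map-∘ ys)) (cartesianProductWith-map f g h xs ys)

module _ {R : A → A → Set} (_≟_ : DecidableEquality B) (f : A → B) where

  Collision : List A → Set
  Collision xs = ∃₂ λ a b → a ∈ xs × b ∈ xs × R a b × f a ≡ f b

  unique-or-collision : ∀ {xs} → AllPairs R xs → Unique (map f xs) ⊎ Collision xs
  unique-or-collision [] = inj₁ []
  unique-or-collision {x ∷ xs} (Rx ∷ Rxs) with Any.any? (λ y → f x ≟ f y) xs | unique-or-collision Rxs
  ... | yes hit | _ =
    let y , y∈xs , fx≡fy = find hit in inj₂ (x , y , here refl , there y∈xs , All.lookup Rx y∈xs , fx≡fy)
  ... | no _    | inj₂ (a , b , a∈xs , b∈xs , Rab , fa≡fb) =
    inj₂ (a , b , there a∈xs , there b∈xs , Rab , fa≡fb)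
  ... | no miss | inj₁ distinct = inj₁ (All.map⁺ (All.¬Any⇒All¬ xs miss) ∷ distinct)

gcdVec∣ : ∀ {n} (x : Vector ℤ n) i → gcdVec x ℕ.∣ ∣ x i ∣
gcdVec∣ x zero    = gcd[m,n]∣m ∣ head x ∣ (gcdVec (tail x))
gcdVec∣ x (suc i) = ℕ.∣-trans (gcd[m,n]∣n ∣ head x ∣ (gcdVec (tail x))) (gcdVec∣ (tail x) i)

gcdVec²≤normSq : ∀ {n} (x : Vector ℤ n) → gcdVec x ℕ.* gcdVec x ℕ.≤ normSq x
gcdVec²≤normSq {zero}  x = ℕ.z≤n
gcdVec²≤normSq {suc n} x with ∣ head x ∣ | gcd[m,n]∣m ∣ head x ∣ (gcdVec (tail x))
... | zero  | _   =
  subst (λ g → g ℕ.* g ℕ.≤ normSq (tail x)) (sym (gcd-identityˡ (gcdVec (tail x)))) (gcdVec²≤normSq (tail x))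
... | suc a | g∣a = ℕ.≤-trans (ℕ.*-mono-≤ g≤a g≤a) (ℕ.m≤m+n (suc a ℕ.* suc a) (normSq (tail x)))
  where g≤a = ℕ.∣⇒≤ g∣a

·-divisible : ∀ {k n} {x : Vector ℤ n} → (∀ i → k ∣ x i) → ∀ c → k ∣ c · x
·-divisible {n = zero}  k∣x c = divides (+ 0) refl
·-divisible {n = suc n} k∣x c =
  ∣m∣n⇒∣m+n (∣n⇒∣m*n (head c) (k∣x zero)) (·-divisible (λ i → k∣x (suc i)) (tail c))

gcdVec∣· : ∀ {n} (x c : Vector ℤ n) → + gcdVec x ∣ c · x
gcdVec∣· x = ·-divisible (λ i → ∣ᵤ⇒∣ (gcdVec∣ x i))

normSq≮gcdVec²*1 : ∀ {n} (x : Vector ℤ n) {k} → k ≡ 1 → ¬ normSq x ℕ.< gcdVec x ℕ.* gcdVec x ℕ.* k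
normSq≮gcdVec²*1 x refl S<g² = ℕ.<⇒≱ S<g² (subst (ℕ._≤ normSq x) (sym (ℕ.*-identityʳ _)) (gcdVec²≤normSq x))

module Spread where

  open import Data.Integer using (_+_; _*_; _-_; -_; _≤_; _<_)

  sum : List ℤ → ℤ
  sum = foldr _+_ (+ 0)

  sumSq : List ℤ → ℤ
  sumSq xs = sum (map (λ x → x * x) xs)

  -- Σᵢ<ⱼ (xᵢ − xⱼ)², i.e. N² times the variance of the N entries.
  spread : List ℤ → ℤ
  spread xs = + length xs * sumSq xs - sum xs * sum xs

  sum-++ : ∀ xs ys → sum (xs ++ ys) ≡ sum xs + sum ys
  sum-++ []       ys = sym (ℤ.+-identityˡ (sum ys))
  sum-++ (x ∷ xs) ys = trans (cong (_+_ x) (sum-++ xs ys)) (sym (ℤ.+-assoc x (sum xs) (sum ys)))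

  sumSq-++ : ∀ xs ys → sumSq (xs ++ ys) ≡ sumSq xs + sumSq ys
  sumSq-++ xs ys = trans (cong sum (List.map-++ _ xs ys)) (sum-++ (map _ xs) (map _ ys))

  sum-↭ : ∀ {xs ys} → xs ↭ ys → sum xs ≡ sum ys
  sum-↭ p = ↭ₛ.foldr-commMonoid ℤ+.setoid ℤ+.isCommutativeMonoid (↭⇒↭ₛ p)
    where module ℤ+ = CommutativeMonoid ℤ.+-0-commutativeMonoid

  spread-↭ : ∀ {xs ys} → xs ↭ ys → spread xs ≡ spread ys
  spread-↭ p = cong₂ _-_
    (cong₂ _*_ (cong +_ (↭.↭-length p)) (sum-↭ (↭.map⁺ _ p)))
    (cong₂ _*_ (sum-↭ p) (sum-↭ p))

  sum-map-+ : ∀ a xs → sum (map (_+_ a) xs) ≡ sum xs + + length xs * a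
  sum-map-+ a []       = sym (ℤ.*-zeroˡ a)
  sum-map-+ a (x ∷ xs) = begin
    (a + x) + sum (map (_+_ a) xs)         ≡⟨ cong (_+_ (a + x)) (sum-map-+ a xs) ⟩
    (a + x) + (sum xs + + length xs * a)   ≡⟨ ring a x (sum xs) (+ length xs) ⟩
    (x + sum xs) + (+ 1 + + length xs) * a ≡⟨ cong (λ n → (x + sum xs) + n * a) (ℤ.pos-+ 1 (length xs)) ⟨
    (x + sum xs) + + suc (length xs) * a   ∎
    where
    open ≡-Reasoning
    ring : ∀ a x s n → (a + x) + (s + n * a) ≡ (x + s) + (+ 1 + n) * a
    ring = solve-∀

  sumSq-map-+ : ∀ a xs → sumSq (map (_+_ a) xs) ≡ sumSq xs + + 2 * a * sum xs + + length xs * (a * a)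
  sumSq-map-+ a []       = ring a
    where ring : ∀ a → + 0 ≡ + 0 + + 2 * a * + 0 + + 0 * (a * a)
          ring = solve-∀
  sumSq-map-+ a (x ∷ xs) = begin
    (a + x) * (a + x) + sumSq (map (_+_ a) xs)
      ≡⟨ cong (_+_ ((a + x) * (a + x))) (sumSq-map-+ a xs) ⟩
    (a + x) * (a + x) + (sumSq xs + + 2 * a * sum xs + + length xs * (a * a))
      ≡⟨ ring a x (sumSq xs) (sum xs) (+ length xs) ⟩
    (x * x + sumSq xs) + + 2 * a * (x + sum xs) + (+ 1 + + length xs) * (a * a)
      ≡⟨ cong (λ n → (x * x + sumSq xs) + + 2 * a * (x + sum xs) + n * (a * a)) (ℤ.pos-+ 1 (length xs)) ⟨
    (x * x + sumSq xs) + + 2 * a * (x + sum xs) + + suc (length xs) * (a * a) ∎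
    where
    open ≡-Reasoning
    ring : ∀ a x q s n → (a + x) * (a + x) + (q + + 2 * a * s + n * (a * a))
                       ≡ (x * x + q) + + 2 * a * (x + s) + (+ 1 + n) * (a * a)
    ring = solve-∀

  sum-map-* : ∀ a xs → sum (map (_* a) xs) ≡ sum xs * a
  sum-map-* a []       = sym (ℤ.*-zeroˡ a)
  sum-map-* a (x ∷ xs) = trans (cong (_+_ (x * a)) (sum-map-* a xs)) (sym (ℤ.*-distribʳ-+ a x (sum xs)))

  sumSq-map-* : ∀ a xs → sumSq (map (_* a) xs) ≡ sumSq xs * (a * a)
  sumSq-map-* a []       = sym (ℤ.*-zeroˡ (a * a))
  sumSq-map-* a (x ∷ xs) = trans (cong (_+_ (x * a * (x * a))) (sumSq-map-* a xs)) (ring x a (sumSq xs))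
    where ring : ∀ x a q → x * a * (x * a) + q * (a * a) ≡ (x * x + q) * (a * a)
          ring = solve-∀

  spread-map-* : ∀ a xs → spread (map (_* a) xs) ≡ spread xs * (a * a)
  spread-map-* a xs = begin
    + length (map (_* a) xs) * sumSq (map (_* a) xs) - sum (map (_* a) xs) * sum (map (_* a) xs)
      ≡⟨ cong₂ (λ n q → + n * q - sum (map (_* a) xs) * sum (map (_* a) xs))
               (List.length-map (_* a) xs) (sumSq-map-* a xs) ⟩
    + length xs * (sumSq xs * (a * a)) - sum (map (_* a) xs) * sum (map (_* a) xs)
      ≡⟨ cong (λ s → + length xs * (sumSq xs * (a * a)) - s * s) (sum-map-* a xs) ⟩
    + length xs * (sumSq xs * (a * a)) - sum xs * a * (sum xs * a)
      ≡⟨ ring (+ length xs) (sumSq xs) (sum xs) a ⟩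
    spread xs * (a * a) ∎
    where
    open ≡-Reasoning
    ring : ∀ n q s a → n * (q * (a * a)) - s * a * (s * a) ≡ (n * q - s * s) * (a * a)
    ring = solve-∀

  spread-∷ : ∀ a xs → spread (a ∷ xs) ≡ spread xs + sumSq (map (_+_ (- a)) xs)
  spread-∷ a xs = begin
    + suc (length xs) * (a * a + sumSq xs) - (a + sum xs) * (a + sum xs)
      ≡⟨ cong (λ n → n * (a * a + sumSq xs) - (a + sum xs) * (a + sum xs)) (ℤ.pos-+ 1 (length xs)) ⟩
    (+ 1 + + length xs) * (a * a + sumSq xs) - (a + sum xs) * (a + sum xs)
      ≡⟨ ring a (+ length xs) (sumSq xs) (sum xs) ⟩
    spread xs + (sumSq xs + + 2 * - a * sum xs + + length xs * (- a * - a))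
      ≡⟨ cong (_+_ (spread xs)) (sumSq-map-+ (- a) xs) ⟨
    spread xs + sumSq (map (_+_ (- a)) xs) ∎
    where
    open ≡-Reasoning
    ring : ∀ a n q s → (+ 1 + n) * (a * a + q) - (a + s) * (a + s)
                     ≡ (n * q - s * s) + (q + + 2 * - a * s + n * (- a * - a))
    ring = solve-∀

  infixl 6 _⊕_
  _⊕_ : List ℤ → List ℤ → List ℤ
  _⊕_ = cartesianProductWith _+_

  sum-⊕ : ∀ xs ys → sum (xs ⊕ ys) ≡ sum xs * + length ys + + length xs * sum ys
  sum-⊕ []       ys = sym (ℤ.*-zeroˡ (sum ys))
  sum-⊕ (x ∷ xs) ys = begin
    sum (map (_+_ x) ys ++ xs ⊕ ys)
      ≡⟨ sum-++ (map (_+_ x) ys) (xs ⊕ ys) ⟩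
    sum (map (_+_ x) ys) + sum (xs ⊕ ys)
      ≡⟨ cong₂ _+_ (sum-map-+ x ys) (sum-⊕ xs ys) ⟩
    (sum ys + m * x) + (sum xs * m + + length xs * sum ys)
      ≡⟨ ring x (sum xs) (sum ys) m (+ length xs) ⟩
    (x + sum xs) * m + (+ 1 + + length xs) * sum ys
      ≡⟨ cong (λ n → (x + sum xs) * m + n * sum ys) (ℤ.pos-+ 1 (length xs)) ⟨
    (x + sum xs) * m + + suc (length xs) * sum ys ∎
    where
    open ≡-Reasoning
    m = + length ys
    ring : ∀ x s t m n → (t + m * x) + (s * m + n * t) ≡ (x + s) * m + (+ 1 + n) * t
    ring = solve-∀

  sumSq-⊕ : ∀ xs ys →
    sumSq (xs ⊕ ys) ≡ sumSq xs * + length ys + + 2 * sum xs * sum ys + + length xs * sumSq ys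
  sumSq-⊕ []       ys = ring (sum ys) (sumSq ys)
    where ring : ∀ t r → + 0 ≡ + 0 * + 0 + + 2 * + 0 * t + + 0 * r
          ring = solve-∀
  sumSq-⊕ (x ∷ xs) ys = begin
    sumSq (map (_+_ x) ys ++ xs ⊕ ys)
      ≡⟨ sumSq-++ (map (_+_ x) ys) (xs ⊕ ys) ⟩
    sumSq (map (_+_ x) ys) + sumSq (xs ⊕ ys)
      ≡⟨ cong₂ _+_ (sumSq-map-+ x ys) (sumSq-⊕ xs ys) ⟩
    (sumSq ys + + 2 * x * sum ys + m * (x * x))
      + (sumSq xs * m + + 2 * sum xs * sum ys + + length xs * sumSq ys)
      ≡⟨ ring x (sum xs) (sumSq xs) (sum ys) (sumSq ys) m (+ length xs) ⟩
    (x * x + sumSq xs) * m + + 2 * (x + sum xs) * sum ys + (+ 1 + + length xs) * sumSq ys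
      ≡⟨ cong (λ n → (x * x + sumSq xs) * m + + 2 * (x + sum xs) * sum ys + n * sumSq ys)
              (ℤ.pos-+ 1 (length xs)) ⟨
    (x * x + sumSq xs) * m + + 2 * (x + sum xs) * sum ys + + suc (length xs) * sumSq ys ∎
    where
    open ≡-Reasoning
    m = + length ys
    ring : ∀ x s q t r m n → (r + + 2 * x * t + m * (x * x)) + (q * m + + 2 * s * t + n * r)
                           ≡ (x * x + q) * m + + 2 * (x + s) * t + (+ 1 + n) * r
    ring = solve-∀

  spread-⊕ : ∀ xs ys →
    spread (xs ⊕ ys) ≡ spread xs * (+ length ys * + length ys) + spread ys * (+ length xs * + length xs)
  spread-⊕ xs ys = begin
    + length (xs ⊕ ys) * sumSq (xs ⊕ ys) - sum (xs ⊕ ys) * sum (xs ⊕ ys)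
      ≡⟨ cong (λ k → + k * sumSq (xs ⊕ ys) - sum (xs ⊕ ys) * sum (xs ⊕ ys))
              (length-cartesianProductWith _+_ xs ys) ⟩
    + (length xs ℕ.* length ys) * sumSq (xs ⊕ ys) - sum (xs ⊕ ys) * sum (xs ⊕ ys)
      ≡⟨ cong₂ (λ k q → k * q - sum (xs ⊕ ys) * sum (xs ⊕ ys))
               (ℤ.pos-* (length xs) (length ys)) (sumSq-⊕ xs ys) ⟩
    n * m * (sumSq xs * m + + 2 * sum xs * sum ys + n * sumSq ys) - sum (xs ⊕ ys) * sum (xs ⊕ ys)
      ≡⟨ cong (λ s → n * m * (sumSq xs * m + + 2 * sum xs * sum ys + n * sumSq ys) - s * s) (sum-⊕ xs ys) ⟩
    n * m * (sumSq xs * m + + 2 * sum xs * sum ys + n * sumSq ys)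
      - (sum xs * m + n * sum ys) * (sum xs * m + n * sum ys)
      ≡⟨ ring n m (sum xs) (sumSq xs) (sum ys) (sumSq ys) ⟩
    spread xs * (m * m) + spread ys * (n * n) ∎
    where
    open ≡-Reasoning
    n = + length xs
    m = + length ys
    ring : ∀ n m s q t r → n * m * (q * m + + 2 * s * t + n * r) - (s * m + n * t) * (s * m + n * t)
                         ≡ (n * q - s * s) * (m * m) + (m * r - t * t) * (n * n)
    ring = solve-∀

  square-mono-≤ : ∀ {u v} → + 0 ≤ u → u ≤ v → u * u ≤ v * v
  square-mono-≤ {u} {v} 0≤u u≤v = ℤ.≤-trans
    (ℤ.*-monoˡ-≤-nonNeg u {{ℤ.nonNegative 0≤u}} u≤v)
    (ℤ.*-monoʳ-≤-nonNeg v {{ℤ.nonNegative (ℤ.≤-trans 0≤u u≤v)}} u≤v)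

  Separated : ℕ → List ℤ → Set
  Separated g = Linked (λ a b → a + + g ≤ b)

  sixSumOfSquares : ℤ → ℤ
  sixSumOfSquares k = k * (k + + 1) * (+ 2 * k + + 1)

  sixSumOfSquares-suc : ∀ k → sixSumOfSquares (k + + 1) ≡ sixSumOfSquares k + + 6 * ((k + + 1) * (k + + 1))
  sixSumOfSquares-suc = ring
    where ring : ∀ k → (k + + 1) * ((k + + 1) + + 1) * (+ 2 * (k + + 1) + + 1)
                     ≡ k * (k + + 1) * (+ 2 * k + + 1) + + 6 * ((k + + 1) * (k + + 1))
          ring = solve-∀

  -- The i-th entry of xs (counting from 1) is at least a + (j + i)g.
  sumSq-distances-≥ : ∀ g a j c xs → + 0 ≤ j → a + j * + g ≤ c → Separated g (c ∷ xs) →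
    + g * + g * (sixSumOfSquares (j + + length xs) - sixSumOfSquares j) ≤ + 6 * sumSq (map (_+_ (- a)) xs)
  sumSq-distances-≥ g a j c []       _   _ _ = ℤ.≤-reflexive (begin
    + g * + g * (sixSumOfSquares (j + + 0) - sixSumOfSquares j)
      ≡⟨ cong (λ k → + g * + g * (sixSumOfSquares k - sixSumOfSquares j)) (ℤ.+-identityʳ j) ⟩
    + g * + g * (sixSumOfSquares j - sixSumOfSquares j)
      ≡⟨ ring (+ g) (sixSumOfSquares j) ⟩
    + 6 * + 0 ∎)
    where
    open ≡-Reasoning
    ring : ∀ g f → g * g * (f - f) ≡ + 6 * + 0
    ring = solve-∀
  sumSq-distances-≥ g a j c (b ∷ xs) 0≤j a+jg≤c (c+g≤b ∷ sep) = begin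
    G * (F (j + + suc (length xs)) - F j)
      ≡⟨ cong (λ k → G * (F (j + k) - F j)) (ℤ.pos-+ 1 (length xs)) ⟩
    G * (F (j + (+ 1 + n)) - F j)
      ≡⟨ cong (λ k → G * (F k - F j)) (ℤ.+-assoc j (+ 1) n) ⟨
    G * (F (j′ + n) - F j)
      ≡⟨ ring (+ g) j′ (F (j′ + n)) (F j) ⟩
    + 6 * (j′ * + g * (j′ * + g)) + G * (F (j′ + n) - (F j + + 6 * (j′ * j′)))
      ≡⟨ cong (λ f → + 6 * (j′ * + g * (j′ * + g)) + G * (F (j′ + n) - f)) (sixSumOfSquares-suc j) ⟨
    + 6 * (j′ * + g * (j′ * + g)) + G * (F (j′ + n) - F j′)
      ≤⟨ ℤ.+-mono-≤ (ℤ.*-monoˡ-≤-nonNeg (+ 6) (square-mono-≤ (ℤ.*-monoʳ-≤-nonNeg (+ g) 0≤j′) j′g≤b-a))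
                    (sumSq-distances-≥ g a j′ b xs 0≤j′ a+j′g≤b sep) ⟩
    + 6 * ((- a + b) * (- a + b)) + + 6 * sumSq (map (_+_ (- a)) xs)
      ≡⟨ ℤ.*-distribˡ-+ (+ 6) ((- a + b) * (- a + b)) (sumSq (map (_+_ (- a)) xs)) ⟨
    + 6 * sumSq (map (_+_ (- a)) (b ∷ xs)) ∎
    where
    open ℤ.≤-Reasoning
    F = sixSumOfSquares
    G = + g * + g
    n = + length xs
    j′ = j + + 1
    0≤j′ : + 0 ≤ j′
    0≤j′ = ℤ.≤-trans 0≤j (ℤ.i≤i+j j (+ 1))
    a+j′g≤b : a + j′ * + g ≤ b
    a+j′g≤b = ℤ.≤-trans (ℤ.≤-reflexive (step a j (+ g))) (ℤ.≤-trans (ℤ.+-monoˡ-≤ (+ g) a+jg≤c) c+g≤b)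
      where step : ∀ a j g → a + (j + + 1) * g ≡ (a + j * g) + g
            step = solve-∀
    j′g≤b-a : j′ * + g ≤ - a + b
    j′g≤b-a = ℤ.≤-trans (ℤ.≤-reflexive (cancel a (j′ * + g))) (ℤ.+-monoʳ-≤ (- a) a+j′g≤b)
      where cancel : ∀ a u → u ≡ - a + (a + u)
            cancel = solve-∀
    ring : ∀ g j f f₀ → g * g * (f - f₀) ≡ + 6 * (j * g * (j * g)) + g * g * (f - (f₀ + + 6 * (j * j)))
    ring = solve-∀

  spread-separated-≥ : ∀ g xs → Separated g xs →
    + g * + g * (+ length xs * + length xs * (+ length xs * + length xs - + 1)) ≤ + 12 * spread xs
  spread-separated-≥ g []       _   = ℤ.≤-reflexive (ring (+ g))
    where ring : ∀ g → g * g * (+ 0 * + 0 * (+ 0 * + 0 - + 1)) ≡ + 12 * (+ 0 * + 0 - + 0 * + 0)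
          ring = solve-∀
  spread-separated-≥ g (a ∷ xs) sep = begin
    + g * + g * (+ suc m * + suc m * (+ suc m * + suc m - + 1))
      ≡⟨ cong (λ k → + g * + g * (k * k * (k * k - + 1))) (ℤ.pos-+ 1 m) ⟩
    + g * + g * ((+ 1 + n) * (+ 1 + n) * ((+ 1 + n) * (+ 1 + n) - + 1))
      ≡⟨ ring (+ g) n ⟩
    + g * + g * (n * n * (n * n - + 1))
      + + 2 * (+ g * + g * (sixSumOfSquares (+ 0 + n) - sixSumOfSquares (+ 0)))
      ≤⟨ ℤ.+-mono-≤ (spread-separated-≥ g xs (Linked.tail sep))
                    (ℤ.*-monoˡ-≤-nonNeg (+ 2) (sumSq-distances-≥ g a (+ 0) a xs ℤ.≤-refl a+0g≤a sep)) ⟩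
    + 12 * spread xs + + 2 * (+ 6 * sumSq (map (_+_ (- a)) xs))
      ≡⟨ ring′ (spread xs) (sumSq (map (_+_ (- a)) xs)) ⟩
    + 12 * (spread xs + sumSq (map (_+_ (- a)) xs))
      ≡⟨ cong (+ 12 *_) (spread-∷ a xs) ⟨
    + 12 * spread (a ∷ xs) ∎
    where
    open ℤ.≤-Reasoning
    m = length xs
    n = + m
    a+0g≤a : a + + 0 * + g ≤ a
    a+0g≤a = ℤ.≤-reflexive (ℤ.+-identityʳ a)
    ring : ∀ g n → g * g * ((+ 1 + n) * (+ 1 + n) * ((+ 1 + n) * (+ 1 + n) - + 1))
         ≡ g * g * (n * n * (n * n - + 1)) + + 2 * (g * g * (n * (n + + 1) * (+ 2 * n + + 1) - + 0))
    ring = solve-∀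
    ring′ : ∀ s q → + 12 * s + + 2 * (+ 6 * q) ≡ + 12 * (s + q)
    ring′ = solve-∀

  distinct-multiples-separated : ∀ g {a b} → + g ∣ a → + g ∣ b → a ≤ b → a ≢ b → a + + g ≤ b
  distinct-multiples-separated g {a} {b} g∣a g∣b a≤b a≢b = begin
    a + + g               ≤⟨ ℤ.+-monoʳ-≤ a g≤b-a ⟩
    a + (b - a)           ≡⟨ ring a b ⟩
    b                     ∎
    where
    open ℤ.≤-Reasoning
    ring : ∀ a b → a + (b - a) ≡ b
    ring = solve-∀
    +∣b-a∣≡b-a : + ∣ b - a ∣ ≡ b - a
    +∣b-a∣≡b-a = ℤ.0≤i⇒+∣i∣≡i (ℤ.i≤j⇒0≤j-i a≤b)
    ∣b-a∣≢0 : ∣ b - a ∣ ≢ 0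
    ∣b-a∣≢0 eq = a≢b (sym (ℤ.i-j≡0⇒i≡j b a (trans (sym +∣b-a∣≡b-a) (cong +_ eq))))
    g≤b-a : + g ≤ b - a
    g≤b-a = ℤ.≤-trans (ℤ.+≤+ (ℕ.∣⇒≤ {{ℕ.≢-nonZero ∣b-a∣≢0}} (∣⇒∣ᵤ (∣m∣n⇒∣m-n g∣b g∣a))))
                      (ℤ.≤-reflexive +∣b-a∣≡b-a)

  sorted-distinct-multiples-separated : ∀ g {xs} →
    Linked _≤_ xs → Unique xs → All (+ g ∣_) xs → Separated g xs
  sorted-distinct-multiples-separated g []            _                  _                       = []
  sorted-distinct-multiples-separated g [-]           _                  _                       = [-]
  sorted-distinct-multiples-separated g (a≤b ∷ sorted) ((a≢b ∷ _) ∷ distinct) (g∣a ∷ g∣xs@(g∣b ∷ _)) =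
    distinct-multiples-separated g g∣a g∣b a≤b a≢b
      ∷ sorted-distinct-multiples-separated g sorted distinct g∣xs

  spread-distinct-multiples-≥ : ∀ g xs → Unique xs → All (+ g ∣_) xs →
    + g * + g * (+ length xs * + length xs * (+ length xs * + length xs - + 1)) ≤ + 12 * spread xs
  spread-distinct-multiples-≥ g xs distinct g∣xs = begin
    + g * + g * (+ length xs * + length xs * (+ length xs * + length xs - + 1))
      ≡⟨ cong (λ n → + g * + g * (+ n * + n * (+ n * + n - + 1))) (↭.↭-length (sort-↭ xs)) ⟨
    + g * + g * (+ length ys * + length ys * (+ length ys * + length ys - + 1))
      ≤⟨ spread-separated-≥ g ys (sorted-distinct-multiples-separated g (sort-↗ xs) distinct′ g∣ys) ⟩
    + 12 * spread ys
      ≡⟨ cong (+ 12 *_) (spread-↭ (sort-↭ xs)) ⟩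
    + 12 * spread xs ∎
    where
    open ℤ.≤-Reasoning
    ys = sort xs
    distinct′ : Unique ys
    distinct′ = ↭ₛ.Unique-resp-↭ (setoid ℤ) (↭⇒↭ₛ (↭-sym (sort-↭ xs))) distinct
    g∣ys : All (+ g ∣_) ys
    g∣ys = ↭.All-resp-↭ (↭-sym (sort-↭ xs)) g∣xs

  spread-bounds-incompatible : ∀ G s k S → 1 ℕ.< s → 0 ℕ.< k → S ℕ.< G ℕ.* (k ℕ.* k) →
    let N = + s * + k in
    ¬ (+ G * (N * N * (N * N - + 1)) ≤ N * N * (+ s * + s - + 1) * + S)
  spread-bounds-incompatible G s k S (ℕ.s≤s (ℕ.s≤s ℕ.z≤n)) (ℕ.s≤s ℕ.z≤n) S<Gk² lower≤upper =
    ℤ.<-irrefl refl (begin-strict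
      + G * (N² - + 1)   ≤⟨ ℤ.*-cancelˡ-≤-pos (+ G * (N² - + 1)) (s²-1 * + S) N² lower≤upper-factored ⟩
      s²-1 * + S         <⟨ ℤ.*-monoˡ-<-pos s²-1 +S<Gk² ⟩
      s²-1 * (+ G * k²)  ≡⟨ ring (+ s) (+ k) (+ G) ⟩
      + G * (N² - k²)    ≤⟨ ℤ.*-monoˡ-≤-nonNeg (+ G) (ℤ.+-monoʳ-≤ N² (ℤ.neg-mono-≤ {+ 1} {k²} 1≤k²)) ⟩
      + G * (N² - + 1)   ∎)
    where
    open ℤ.≤-Reasoning
    N² = (+ s * + k) * (+ s * + k)
    s²-1 = + s * + s - + 1
    k² = + k * + k
    1≤k² : + 1 ≤ k²
    1≤k² = ℤ.+≤+ (ℕ.s≤s ℕ.z≤n)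
    lower≤upper-factored : N² * (+ G * (N² - + 1)) ≤ N² * (s²-1 * + S)
    lower≤upper-factored = subst₂ _≤_ (factor-out (+ G) N²) (ℤ.*-assoc N² s²-1 (+ S)) lower≤upper
      where factor-out : ∀ G M → G * (M * (M - + 1)) ≡ M * (G * (M - + 1))
            factor-out = solve-∀
    +S<Gk² : + S < + G * k²
    +S<Gk² = subst (+ S <_) (trans (ℤ.pos-* G (k ℕ.* k)) (cong (+ G *_) (ℤ.pos-* k k))) (ℤ.+<+ S<Gk²)
    ring : ∀ s k G → (s * s - + 1) * (G * (k * k)) ≡ G * ((s * k) * (s * k) - k * k)
    ring = solve-∀

module Cube where

  open import Data.Integer using (_+_; _*_; _-_; -_; _≤_)
  open Spread

  coords : ℕ → List ℤ
  coords d = applyDownFrom +_ (suc d)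

  cube : ℕ → (n : ℕ) → List (Vector ℤ n)
  cube d zero    = [ Vector.[] ]
  cube d (suc n) = cartesianProductWith Vector._∷_ (coords d) (cube d n)

  InCube : ℕ → ∀ {n} → Vector ℤ n → Set
  InCube d c = ∀ i → + 0 ≤ c i × c i ≤ + d

  length-cube : ∀ d n → length (cube d n) ≡ suc d ℕ.^ n
  length-cube d zero    = refl
  length-cube d (suc n) = begin
    length (cartesianProductWith Vector._∷_ (coords d) (cube d n))
      ≡⟨ length-cartesianProductWith Vector._∷_ (coords d) (cube d n) ⟩
    length (coords d) ℕ.* length (cube d n)
      ≡⟨ cong₂ ℕ._*_ (List.length-applyDownFrom +_ (suc d)) (length-cube d n) ⟩
    suc d ℕ.* suc d ℕ.^ n ∎
    where open ≡-Reasoning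

  cube⊆InCube : ∀ d n → All (InCube d) (cube d n)
  cube⊆InCube d zero    = (λ ()) ∷ []
  cube⊆InCube d (suc n) =
    All.cartesianProductWith⁺ (setoid ℤ) (setoid (Vector ℤ n)) Vector._∷_ (coords d) (cube d n) inCube
    where
    inCube : ∀ {k c} → k ∈ coords d → c ∈ cube d n → InCube d (k Vector.∷ c)
    inCube k∈ c∈ zero    with i , i<1+d , refl ← ∈-applyDownFrom⁻ +_ k∈ = ℤ.+≤+ ℕ.z≤n , ℤ.+≤+ (ℕ.s≤s⁻¹ i<1+d)
    inCube k∈ c∈ (suc i) = All.lookup (cube⊆InCube d n) c∈ i

  cube-unique : ∀ d n → Setoid.Unique (Fin n →-setoid ℤ) (cube d n)
  cube-unique d zero    = [] ∷ []
  cube-unique d (suc n) = Setoid.cartesianProductWith⁺ (setoid ℤ) (Fin n →-setoid ℤ) (Fin (suc n) →-setoid ℤ)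
    Vector._∷_ (λ eq → eq zero , λ i → eq (suc i))
    (Unique.applyDownFrom⁺₁ +_ (suc d) (λ j<i _ eq → ℕ.<⇒≢ j<i (sym (ℤ.+-injective eq))))
    (cube-unique d n)

  cube-values : ∀ d n (x : Vector ℤ (suc n)) →
    map (_· x) (cube d (suc n)) ≡ map (_* head x) (coords d) ⊕ map (_· tail x) (cube d n)
  cube-values d n x = trans (map-cartesianProductWith (_· x) Vector._∷_ (coords d) (cube d n))
                            (sym (cartesianProductWith-map _+_ (_* head x) (_· tail x) (coords d) (cube d n)))

  sum-coords : ∀ d → + 2 * sum (coords d) ≡ + suc d * (+ suc d - + 1)
  sum-coords zero    = refl
  sum-coords (suc d) = begin
    + 2 * (n + sum (coords d))     ≡⟨ ℤ.*-distribˡ-+ (+ 2) n (sum (coords d)) ⟩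
    + 2 * n + + 2 * sum (coords d) ≡⟨ cong (_+_ (+ 2 * n)) (sum-coords d) ⟩
    + 2 * n + n * (n - + 1)        ≡⟨ ring n ⟩
    (+ 1 + n) * ((+ 1 + n) - + 1)  ≡⟨ cong (λ k → k * (k - + 1)) (ℤ.pos-+ 1 (suc d)) ⟨
    + suc (suc d) * (+ suc (suc d) - + 1) ∎
    where
    open ≡-Reasoning
    n = + suc d
    ring : ∀ n → + 2 * n + n * (n - + 1) ≡ (+ 1 + n) * ((+ 1 + n) - + 1)
    ring = solve-∀

  sumSq-coords : ∀ d → + 6 * sumSq (coords d) ≡ + suc d * (+ suc d - + 1) * (+ 2 * + suc d - + 1)
  sumSq-coords zero    = refl
  sumSq-coords (suc d) = begin
    + 6 * (n * n + sumSq (coords d))       ≡⟨ ℤ.*-distribˡ-+ (+ 6) (n * n) (sumSq (coords d)) ⟩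
    + 6 * (n * n) + + 6 * sumSq (coords d) ≡⟨ cong (_+_ (+ 6 * (n * n))) (sumSq-coords d) ⟩
    + 6 * (n * n) + n * (n - + 1) * (+ 2 * n - + 1)
      ≡⟨ ring n ⟩
    (+ 1 + n) * ((+ 1 + n) - + 1) * (+ 2 * (+ 1 + n) - + 1)
      ≡⟨ cong (λ k → k * (k - + 1) * (+ 2 * k - + 1)) (ℤ.pos-+ 1 (suc d)) ⟨
    + suc (suc d) * (+ suc (suc d) - + 1) * (+ 2 * + suc (suc d) - + 1) ∎
    where
    open ≡-Reasoning
    n = + suc d
    ring : ∀ n → + 6 * (n * n) + n * (n - + 1) * (+ 2 * n - + 1)
               ≡ (+ 1 + n) * ((+ 1 + n) - + 1) * (+ 2 * (+ 1 + n) - + 1)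
    ring = solve-∀

  spread-coords : ∀ d → + 12 * spread (coords d) ≡ + suc d * + suc d * (+ suc d * + suc d - + 1)
  spread-coords d = begin
    + 12 * (+ length (coords d) * sumSq (coords d) - sum (coords d) * sum (coords d))
      ≡⟨ cong (λ k → + 12 * (+ k * sumSq (coords d) - sum (coords d) * sum (coords d)))
              (List.length-applyDownFrom +_ (suc d)) ⟩
    + 12 * (n * sumSq (coords d) - sum (coords d) * sum (coords d))
      ≡⟨ ring n (sumSq (coords d)) (sum (coords d)) ⟩
    + 2 * n * (+ 6 * sumSq (coords d)) - + 3 * ((+ 2 * sum (coords d)) * (+ 2 * sum (coords d)))
      ≡⟨ cong₂ (λ q s → + 2 * n * q - + 3 * (s * s)) (sumSq-coords d) (sum-coords d) ⟩
    + 2 * n * (n * (n - + 1) * (+ 2 * n - + 1)) - + 3 * ((n * (n - + 1)) * (n * (n - + 1)))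
      ≡⟨ ring′ n ⟩
    n * n * (n * n - + 1) ∎
    where
    open ≡-Reasoning
    n = + suc d
    ring : ∀ n q s → + 12 * (n * q - s * s) ≡ + 2 * n * (+ 6 * q) - + 3 * ((+ 2 * s) * (+ 2 * s))
    ring = solve-∀
    ring′ : ∀ n → + 2 * n * (n * (n - + 1) * (+ 2 * n - + 1)) - + 3 * ((n * (n - + 1)) * (n * (n - + 1)))
                ≡ n * n * (n * n - + 1)
    ring′ = solve-∀

  +∣i∣*∣i∣≡i*i : ∀ i → + (∣ i ∣ ℕ.* ∣ i ∣) ≡ i * i
  +∣i∣*∣i∣≡i*i (+ n)    = ℤ.pos-* n n
  +∣i∣*∣i∣≡i*i -[1+ n ] = refl

  spread-cube-values : ∀ d n (x : Vector ℤ n) →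
    + 12 * spread (map (_· x) (cube d n))
      ≡ + (suc d ℕ.^ n) * + (suc d ℕ.^ n) * (+ suc d * + suc d - + 1) * + normSq x
  spread-cube-values d zero    x = sym (ℤ.*-zeroʳ (+ 1 * + 1 * (+ suc d * + suc d - + 1)))
  spread-cube-values d (suc n) x = begin
    + 12 * spread (map (_· x) (cube d (suc n)))
      ≡⟨ cong (λ xs → + 12 * spread xs) (cube-values d n x) ⟩
    + 12 * spread (scaled ⊕ values)
      ≡⟨ cong (+ 12 *_) (spread-⊕ scaled values) ⟩
    + 12 * (spread scaled * (+ length values * + length values)
            + spread values * (+ length scaled * + length scaled))
      ≡⟨ cong₂ (λ k l → + 12 * (spread scaled * (+ k * + k) + spread values * (+ l * + l)))
               length-values length-scaled ⟩
    + 12 * (spread scaled * (count * count) + spread values * (side * side))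
      ≡⟨ ring (spread scaled) (spread values) count side ⟩
    + 12 * spread scaled * (count * count) + + 12 * spread values * (side * side)
      ≡⟨ cong₂ (λ s t → s * (count * count) + t * (side * side))
               12*spread-scaled (spread-cube-values d n (tail x)) ⟩
    side * side * E * x₀² * (count * count) + count * count * E * + normSq (tail x) * (side * side)
      ≡⟨ ring′ side count E x₀² (+ normSq (tail x)) ⟩
    (side * count) * (side * count) * E * (x₀² + + normSq (tail x))
      ≡⟨ cong₂ (λ k s → k * k * E * s) (ℤ.pos-* (suc d) (suc d ℕ.^ n)) normSq-head-tail ⟨
    + (suc d ℕ.^ suc n) * + (suc d ℕ.^ suc n) * E * + normSq x ∎
    where
    open ≡-Reasoning
    scaled = map (_* head x) (coords d)
    values = map (_· tail x) (cube d n)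
    side = + suc d
    count = + (suc d ℕ.^ n)
    E = side * side - + 1
    x₀² = head x * head x
    length-scaled : length scaled ≡ suc d
    length-scaled = trans (List.length-map (_* head x) (coords d)) (List.length-applyDownFrom +_ (suc d))
    length-values : length values ≡ suc d ℕ.^ n
    length-values = trans (List.length-map (_· tail x) (cube d n)) (length-cube d n)
    12*spread-scaled : + 12 * spread scaled ≡ side * side * E * x₀²
    12*spread-scaled = begin
      + 12 * spread scaled          ≡⟨ cong (+ 12 *_) (spread-map-* (head x) (coords d)) ⟩
      + 12 * (spread (coords d) * x₀²) ≡⟨ ℤ.*-assoc (+ 12) (spread (coords d)) x₀² ⟨
      + 12 * spread (coords d) * x₀²   ≡⟨ cong (_* x₀²) (spread-coords d) ⟩
      side * side * E * x₀²            ∎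
    normSq-head-tail : + normSq x ≡ x₀² + + normSq (tail x)
    normSq-head-tail = trans (ℤ.pos-+ (∣ head x ∣ ℕ.* ∣ head x ∣) (normSq (tail x)))
                             (cong (_+ + normSq (tail x)) (+∣i∣*∣i∣≡i*i (head x)))
    ring : ∀ s t c k → + 12 * (s * (c * c) + t * (k * k)) ≡ + 12 * s * (c * c) + + 12 * t * (k * k)
    ring = solve-∀
    ring′ : ∀ k c e a S → k * k * e * a * (c * c) + c * c * e * S * (k * k) ≡ (k * c) * (k * c) * e * (a + S)
    ring′ = solve-∀

  ·-distribʳ-sub : ∀ {n} (c c′ x : Vector ℤ n) → (λ i → c i - c′ i) · x ≡ c · x - c′ · x
  ·-distribʳ-sub {zero}  c c′ x = refl
  ·-distribʳ-sub {suc n} c c′ x =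
    trans (cong (_+_ ((head c - head c′) * head x)) (·-distribʳ-sub (tail c) (tail c′) (tail x)))
          (ring (head c) (head c′) (head x) (tail c · tail x) (tail c′ · tail x))
    where ring : ∀ a b x s t → (a - b) * x + (s - t) ≡ (a * x + s) - (b * x + t)
          ring = solve-∀

  difference-solution : ∀ d {n} (x : Vector ℤ n) {c c′ : Vector ℤ n} →
    InCube d c → InCube d c′ → ¬ (∀ i → c i ≡ c′ i) → c · x ≡ c′ · x →
    Σ (Vector ℤ n) λ b → InBox d b × NonZeroVec b × b · x ≡ + 0
  difference-solution d x {c} {c′} c∈cube c′∈cube c≉c′ c·x≡c′·x =
    (λ i → c i - c′ i) , inBox , nonZero , trans (·-distribʳ-sub c c′ x) (ℤ.i≡j⇒i-j≡0 c·x≡c′·x)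
    where
    inBox : InBox d (λ i → c i - c′ i)
    inBox i with c∈cube i | c′∈cube i
    ... | 0≤a , a≤d | 0≤b , b≤d =
      ℤ.≤-trans (ℤ.≤-reflexive (sym (ℤ.+-identityˡ (- + d)))) (ℤ.+-mono-≤ 0≤a (ℤ.neg-mono-≤ b≤d)) ,
      ℤ.≤-trans (ℤ.+-mono-≤ a≤d (ℤ.neg-mono-≤ 0≤b)) (ℤ.≤-reflexive (ℤ.+-identityʳ (+ d)))
    nonZero : NonZeroVec (λ i → c i - c′ i)
    nonZero c-c′≡0 = c≉c′ (λ i → ℤ.i-j≡0⇒i≡j (c i) (c′ i) (c-c′≡0 i))

  cube-values-not-unique : ∀ d m (x : Vector ℤ (suc m)) →
    normSq x ℕ.< gcdVec x ℕ.* gcdVec x ℕ.* (suc (suc d) ℕ.^ (2 ℕ.* m)) →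
    ¬ Unique (map (_· x) (cube (suc d) (suc m)))
  cube-values-not-unique d m x S<g²D²ᵐ distinct =
    spread-bounds-incompatible (g ℕ.* g) D (D ℕ.^ m) (normSq x) (ℕ.s≤s (ℕ.s≤s ℕ.z≤n)) (ℕ.m^n>0 D m)
      (subst (λ k → normSq x ℕ.< g ℕ.* g ℕ.* k) D^[2m]≡D^m*D^m S<g²D²ᵐ) (begin
      + (g ℕ.* g) * (N * N * (N * N - + 1))
        ≡⟨ cong₂ (λ G n → G * (n * n * (n * n - + 1))) (ℤ.pos-* g g) (sym length-values) ⟩
      + g * + g * (+ length values * + length values * (+ length values * + length values - + 1))
        ≤⟨ spread-distinct-multiples-≥ g values distinct g∣values ⟩
      + 12 * spread values
        ≡⟨ spread-cube-values (suc d) (suc m) x ⟩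
      + (D ℕ.^ suc m) * + (D ℕ.^ suc m) * (+ D * + D - + 1) * + normSq x
        ≡⟨ cong (λ n → n * n * (+ D * + D - + 1) * + normSq x) (ℤ.pos-* D (D ℕ.^ m)) ⟩
      N * N * (+ D * + D - + 1) * + normSq x ∎)
    where
    open ℤ.≤-Reasoning
    D = suc (suc d)
    g = gcdVec x
    N = + D * + (D ℕ.^ m)
    cube′ = cube (suc d) (suc m)
    values = map (_· x) cube′
    length-values : + length values ≡ N
    length-values = trans (cong +_ (trans (List.length-map (_· x) cube′) (length-cube (suc d) (suc m))))
                          (ℤ.pos-* D (D ℕ.^ m))
    g∣values : All (+ g ∣_) values
    g∣values = All.map⁺ (All.universal (gcdVec∣· x) cube′)
    D^[2m]≡D^m*D^m : D ℕ.^ (2 ℕ.* m) ≡ D ℕ.^ m ℕ.* D ℕ.^ m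
    D^[2m]≡D^m*D^m =
      trans (ℕ.^-distribˡ-+-* D m (m ℕ.+ 0)) (cong (λ k → D ℕ.^ m ℕ.* D ℕ.^ k) (ℕ.+-identityʳ m))

open Cube using (cube-unique; cube⊆InCube; cube-values-not-unique; difference-solution)
open import Data.Nat using (_*_; _^_; _<_; _∸_)

theorem3p1 : (d n : ℕ) (x : Fin n → ℤ) → NonZeroVec x →
    normSq x < (gcdVec x * gcdVec x) * (suc d ^ (2 * (n ∸ 1))) →
    Σ (Fin n → ℤ) (λ c → InBox d c × NonZeroVec c × (c · x ≡ + 0))
theorem3p1 zero    n       x _ S<g²1ᵏ = ⊥-elim (normSq≮gcdVec²*1 x (ℕ.^-zeroˡ (2 * (n ∸ 1))) S<g²1ᵏ)
theorem3p1 (suc d) zero    x _ S<g²   = ⊥-elim (normSq≮gcdVec²*1 x refl S<g²)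
theorem3p1 (suc d) (suc m) x _ S<g²D²ᵐ with unique-or-collision ℤ._≟_ (_· x) (cube-unique (suc d) (suc m))
... | inj₁ distinct = ⊥-elim (cube-values-not-unique d m x S<g²D²ᵐ distinct)
... | inj₂ (c , c′ , c∈cube , c′∈cube , c≉c′ , c·x≡c′·x) =
  difference-solution (suc d) x (All.lookup (cube⊆InCube (suc d) (suc m)) c∈cube)
    (All.lookup (cube⊆InCube (suc d) (suc m)) c′∈cube) c≉c′ c·x≡c′·x
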